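{- Let $T$ be a tree (with at least one edge). Then $\chi_i'(T)=1$ if $T$ is a star; $\chi_i'(T)=3$ if $\bar{T}$ contains an odd cycle; and $\chi_i'(T)=2$ in every other case.
   Context: For a graph $G$ with at least one edge, $\bar{G}$ (not the complement) is the graph whose vertex set is $E(G)$, where two vertices $x,y$ are adjacent if and only if there is an edge $e\in E(G)$ such that $x,e,y$ are consecutive edges of $G$. Three edges $e_1,e_2,e_3$ (in this order) are consecutive if $e_1=xy$, $e_2=yz$, $e_3=zu$ for some vertices $x,y,z,u$ (where $x=u$ is allowed). An injective edge coloring of $G$ is a map $c:E(G)\to\mathcal{C}$ such that whenever $e_1,e_2,e_3$ are consecutive edges, $c(e_1)\neq c(e_3)$. $\chi_i'(G)$ is the minimum number of colors in an injective edge coloring of $G$. A star is $K_{1,q}$ with $q\ge1$. -}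

module Defs where

open import Data.Nat using (ℕ; zero; suc; _+_; _≤_)
open import Data.Fin using (Fin; zero; suc; fromℕ; inject₁; _<_)
open import Data.Bool using (Bool; true)
open import Data.Product using (Σ; Σ-syntax; ∃; ∃-syntax; _×_)
open import Data.Sum using (_⊎_)
open import Relation.Binary.PropositionalEquality using (_≡_; _≢_)
open import Relation.Binary.Construct.Closure.ReflexiveTransitive using (Star)
open import Function.Definitions using (Injective)

record Graph (n : ℕ) : Set where
  field
    adj   : Fin n → Fin n → Bool
    sym   : ∀ a b → adj a b ≡ adj b a
    irrefl : ∀ a → adj a a ≢ true
open Graph public

Adj : ∀ {n} → Graph n → Fin n → Fin n → Set
Adj G a b = adj G a b ≡ true

-- An edge is an unordered pair {src, tgt} of adjacent vertices, stored
-- with src < tgt (proof fields irrelevant, so an edge is determined by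
-- its endpoints).
record Edge {n : ℕ} (G : Graph n) : Set where
  constructor edge
  field
    src  : Fin n
    tgt  : Fin n
    .ord : src < tgt
    .isE : Adj G src tgt
open Edge public

HasEdge : ∀ {n} → Graph n → Set
HasEdge G = Edge G

Ends : ∀ {n} {G : Graph n} → Edge G → Fin n → Fin n → Set
Ends e a b = (src e ≡ a × tgt e ≡ b) ⊎ (src e ≡ b × tgt e ≡ a)

Consecutive : ∀ {n} {G : Graph n} → Edge G → Edge G → Edge G → Set
Consecutive {n} e₁ e₂ e₃ =
  (e₁ ≢ e₂) × (e₂ ≢ e₃) × (e₁ ≢ e₃) ×
  (Σ[ x ∈ Fin n ] Σ[ y ∈ Fin n ] Σ[ z ∈ Fin n ] Σ[ u ∈ Fin n ]
     (Ends e₁ x y × Ends e₂ y z × Ends e₃ z u))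

InjectiveEdgeColouring : ∀ {n} → Graph n → ℕ → Set
InjectiveEdgeColouring G k =
  Σ[ c ∈ (Edge G → Fin k) ]
    (∀ e₁ e₂ e₃ → Consecutive e₁ e₂ e₃ → c e₁ ≢ c e₃)

χᵢ'≡ : ∀ {n} → Graph n → ℕ → Set
χᵢ'≡ G m = InjectiveEdgeColouring G m × (∀ k → InjectiveEdgeColouring G k → m ≤ k)

record Cycle {V : Set} (R : V → V → Set) (len : ℕ) : Set where
  field
    m      : ℕ
    len≡   : len ≡ suc m
    long   : 3 ≤ suc m
    vtx    : Fin (suc m) → V
    inj    : Injective _≡_ _≡_ vtx
    step   : ∀ (i : Fin m) → R (vtx (inject₁ i)) (vtx (suc i))
    close  : R (vtx (fromℕ m)) (vtx zero)

Odd : ℕ → Set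
Odd k = Σ[ j ∈ ℕ ] k ≡ suc (j + j)

Connected : ∀ {n} → Graph n → Set
Connected G = ∀ a b → Star (Adj G) a b

Acyclic : ∀ {n} → Graph n → Set
Acyclic G = ∀ k → Cycle (Adj G) k → Data.Empty.⊥
  where import Data.Empty

IsTree : ∀ {n} → Graph n → Set
IsTree G = Connected G × Acyclic G

IsStar : ∀ {n} → Graph n → Set
IsStar {n} G =
  HasEdge G ×
  (Σ[ c ∈ Fin n ] ((∀ v → v ≢ c → Adj G c v) ×
                   (∀ a b → Adj G a b → (a ≡ c ⊎ b ≡ c))))

BarAdj : ∀ {n} (G : Graph n) → Edge G → Edge G → Set
BarAdj G x y = Σ[ e ∈ Edge G ] Consecutive x e y

BarHasOddCycle : ∀ {n} → Graph n → Set
BarHasOddCycle G = Σ[ k ∈ ℕ ] (Odd k × Cycle (BarAdj G) k)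

module Submission where

-- An injective edge colouring of G is precisely a proper vertex colouring of
-- the graph Ḡ on E(G), so χᵢ'(G) is the chromatic number of Ḡ.  For a tree T
-- with an edge:
--   * T is a star  ⇔  no three edges are consecutive  ⇔  Ḡ has no edges,
--     so χᵢ'(T) = 1 exactly for stars;
--   * one colour fails as soon as Ḡ has an edge, and two colours fail as soon
--     as Ḡ has an odd cycle (a proper 2-colouring forces closed walks to be
--     even);
--   * two colours suffice when Ḡ has no odd cycle (a finite graph without odd
--     cycles is bipartite), and three colours always suffice: rooting T, the
--     deeper ends of the first and last of three consecutive edges differ in
--     depth by one or two, so colouring an edge by the depth of its deeper end
--     modulo 3 is injective.

open import Defs hiding (sym)
open import Data.Nat using (ℕ; zero; suc; _+_; _*_; _≤_; _<_; z≤n; s≤s; _≤?_; _⊔_; parity)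
open import Data.Nat.Properties
  using (≤-refl; ≤-trans; ≤-antisym; ≤-reflexive; ≤-pred; <-irrefl; ≰⇒>; m≤m+n; m≤n+m; m<n+m;
         <⇒≤; <-trans; <-≤-trans; suc-injective; 1+n≢0; n≤1+n; m≤n⇒m⊔n≡n; m≥n⇒m⊔n≡m;
         +-suc; +-comm; +-assoc; +-monoʳ-<; ⊔-comm; n≤0⇒n≡0; module ≤-Reasoning)
  renaming (<-cmp to ℕ-cmp)
open import Data.Parity.Base using (Parity; 0ℙ; 1ℙ; _⁻¹) renaming (_+_ to _⊕_)
open import Data.Parity.Properties
  using (+-identityʳ; +-homo-+; suc-homo-⁻¹; ⁻¹-selfInverse; p+p≡0ℙ; p+p⁻¹≡1ℙ; p≢p⁻¹)
  renaming (+-comm to ⊕-comm)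
open import Data.Fin as Fin using (Fin; zero; suc; fromℕ; inject₁; inject≤; toℕ; combine; remQuot)
open import Data.Fin.Properties using (any?; injective⇒≤; inject≤-injective; remQuot-combine; <-asym; <-cmp)
  renaming (_<?_ to _<ᶠ?_)
open import Data.Bool using (true)
import Data.Bool.Properties as Bool
open import Data.Product using (Σ; _×_; _,_; proj₁; proj₂)
open import Data.Sum using (_⊎_; inj₁; inj₂; [_,_]′)
open import Data.Unit using (⊤; tt)
open import Data.Empty using (⊥; ⊥-elim)
open import Relation.Nullary using (¬_; Dec; yes; no; _×-dec_; ¬?)
open import Relation.Nullary.Decidable using (recompute; _⊎-dec_)
open import Relation.Binary.Definitions using (DecidableEquality; tri<; tri≈; tri>)
open import Relation.Binary.PropositionalEquality
  using (_≡_; _≢_; refl; sym; trans; cong; cong₂; subst; subst₂; module ≡-Reasoning)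
open import Relation.Binary.Construct.Closure.ReflexiveTransitive using (Star; ε; _◅_)
open import Function.Definitions using (Injective)
open import Induction.WellFounded using (Acc; acc)
open import Data.Nat.Induction using (<-wellFounded)

parity-suc : ∀ n → parity (suc n) ≡ parity n ⁻¹
parity-suc n = sym (⁻¹-selfInverse (suc-homo-⁻¹ n))

odd⇒parity : ∀ {k} → Odd k → parity k ≡ 1ℙ
odd⇒parity (j , refl) = begin
  parity (suc (j + j))         ≡⟨ parity-suc (j + j) ⟩
  parity (j + j) ⁻¹            ≡⟨ cong _⁻¹ (+-homo-+ j j) ⟩
  (parity j ⊕ parity j) ⁻¹     ≡⟨ cong _⁻¹ (p+p≡0ℙ (parity j)) ⟩
  1ℙ                           ∎
  where open ≡-Reasoning

parity⇒odd : ∀ k → parity k ≡ 1ℙ → Odd k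
parity⇒odd (suc zero) _ = 0 , refl
parity⇒odd (suc (suc k)) p with parity⇒odd k p
... | j , k≡ = suc j , cong (λ t → suc (suc t)) (trans k≡ (sym (+-suc j j)))

≢⇒opposite : ∀ {p q : Parity} → p ≢ q → q ≡ p ⁻¹
≢⇒opposite {0ℙ} {0ℙ} p≢q = ⊥-elim (p≢q refl)
≢⇒opposite {0ℙ} {1ℙ} _   = refl
≢⇒opposite {1ℙ} {0ℙ} _   = refl
≢⇒opposite {1ℙ} {1ℙ} p≢q = ⊥-elim (p≢q refl)

⁻¹-shift : ∀ p q → p ⁻¹ ⊕ q ≡ p ⊕ q ⁻¹
⁻¹-shift 0ℙ 0ℙ = refl
⁻¹-shift 0ℙ 1ℙ = refl
⁻¹-shift 1ℙ 0ℙ = refl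
⁻¹-shift 1ℙ 1ℙ = refl

toParity : Fin 2 → Parity
toParity zero       = 0ℙ
toParity (suc zero) = 1ℙ

toParity-injective : Injective _≡_ _≡_ toParity
toParity-injective {zero}     {zero}     _ = refl
toParity-injective {suc zero} {suc zero} _ = refl
toParity-injective {zero}     {suc zero} ()
toParity-injective {suc zero} {zero}     ()

fromParity : Parity → Fin 2
fromParity 0ℙ = zero
fromParity 1ℙ = suc zero

fromParity-injective : Injective _≡_ _≡_ fromParity
fromParity-injective {0ℙ} {0ℙ} _ = refl
fromParity-injective {1ℙ} {1ℙ} _ = refl
fromParity-injective {0ℙ} {1ℙ} ()
fromParity-injective {1ℙ} {0ℙ} ()

leastℕ : {P : ℕ → Set} → (∀ k → Dec (P k)) → ∀ b → P b →
         Σ ℕ λ m → P m × (∀ k → k < m → ¬ P k)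
leastℕ P? zero    pb = 0 , pb , λ _ ()
leastℕ P? (suc b) pb with P? zero
... | yes p0 = 0 , p0 , λ _ ()
... | no ¬p0 with leastℕ (λ k → P? (suc k)) b pb
...   | m , pm , below = suc m , pm , λ { zero _ → ¬p0 ; (suc k) (s≤s k<m) → below k k<m }

leastFin : ∀ {M} {P : Fin M → Set} → (∀ i → Dec (P i)) → Σ (Fin M) P →
           Σ (Fin M) λ i → P i × (∀ j → toℕ j < toℕ i → ¬ P j)
leastFin {suc M} P? (i , pi) with P? zero
... | yes p0 = zero , p0 , λ j ()
... | no ¬p0 with i
...   | zero   = ⊥-elim (¬p0 pi)
...   | suc i′ with leastFin (λ j → P? (suc j)) (i′ , pi)
...     | m , pm , below = suc m , pm , λ { zero _ → ¬p0 ; (suc j) (s≤s j<m) → below j j<m }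

module Walks {V : Set} (R : V → V → Set) where

  infixr 5 _∷_ _++_
  data Walk : V → V → Set where
    []  : ∀ {u} → Walk u u
    _∷_ : ∀ {u w v} → R u w → Walk w v → Walk u v

  len : ∀ {u v} → Walk u v → ℕ
  len []      = 0
  len (_ ∷ w) = suc (len w)

  _++_ : ∀ {u w v} → Walk u w → Walk w v → Walk u v
  []      ++ q = q
  (r ∷ p) ++ q = r ∷ (p ++ q)

  len-++ : ∀ {u w v} (p : Walk u w) (q : Walk w v) → len (p ++ q) ≡ len p + len q
  len-++ []      q = refl
  len-++ (r ∷ p) q = cong suc (len-++ p q)

  snoc : ∀ {u w v} → Walk u w → R w v → Walk u v
  snoc p r = p ++ (r ∷ [])

  len-snoc : ∀ {u w v} (p : Walk u w) (r : R w v) → len (snoc p r) ≡ suc (len p)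
  len-snoc p r = trans (len-++ p (r ∷ [])) (+-comm (len p) 1)

  len0⇒≡ : ∀ {u v} (w : Walk u v) → len w ≡ 0 → u ≡ v
  len0⇒≡ [] _ = refl

  lastStep : ∀ {u v} (w : Walk u v) → 0 < len w →
             Σ V λ x → Σ (Walk u x) λ w′ → R x v × len w ≡ suc (len w′)
  lastStep (r ∷ [])       _ = _ , [] , r , refl
  lastStep (r ∷ (r′ ∷ w)) _ with lastStep (r′ ∷ w) (s≤s z≤n)
  ... | x , w′ , rx , eq = x , r ∷ w′ , rx , cong suc eq

  infix 4 _∈W_
  _∈W_ : ∀ {u v} → V → Walk u v → Set
  _∈W_ {u} x []      = x ≡ u
  _∈W_ {u} x (r ∷ w) = x ≡ u ⊎ x ∈W w

  ∈-++ˡ : ∀ {u w v x} (p : Walk u w) (q : Walk w v) → x ∈W p → x ∈W (p ++ q)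
  ∈-++ˡ []      []      x∈ = x∈
  ∈-++ˡ []      (r ∷ q) x∈ = inj₁ x∈
  ∈-++ˡ (r ∷ p) q (inj₁ x≡) = inj₁ x≡
  ∈-++ˡ (r ∷ p) q (inj₂ x∈) = inj₂ (∈-++ˡ p q x∈)

  ∈-++ʳ : ∀ {u w v x} (p : Walk u w) (q : Walk w v) → x ∈W q → x ∈W (p ++ q)
  ∈-++ʳ []      q x∈ = x∈
  ∈-++ʳ (r ∷ p) q x∈ = inj₂ (∈-++ʳ p q x∈)

  ∈-++⁻ : ∀ {u w v x} (p : Walk u w) (q : Walk w v) → x ∈W (p ++ q) → x ∈W p ⊎ x ∈W q
  ∈-++⁻ []      q x∈        = inj₂ x∈
  ∈-++⁻ (r ∷ p) q (inj₁ x≡) = inj₁ (inj₁ x≡)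
  ∈-++⁻ (r ∷ p) q (inj₂ x∈) with ∈-++⁻ p q x∈
  ... | inj₁ x∈p = inj₁ (inj₂ x∈p)
  ... | inj₂ x∈q = inj₂ x∈q

  splitAt : ∀ {u v x} (w : Walk u v) → x ∈W w →
            Σ (Walk u x) λ p → Σ (Walk x v) λ q → w ≡ p ++ q
  splitAt []      refl       = [] , [] , refl
  splitAt (r ∷ w) (inj₁ refl) = [] , r ∷ w , refl
  splitAt (r ∷ w) (inj₂ x∈)  with splitAt w x∈
  ... | p , q , eq = r ∷ p , q , cong (r ∷_) eq

  vertexAt : ∀ {u v} (w : Walk u v) → Fin (suc (len w)) → V
  vertexAt {u} w       zero    = u
  vertexAt     (r ∷ w) (suc i) = vertexAt w i

  vertexAt-last : ∀ {u v} (w : Walk u v) → vertexAt w (fromℕ (len w)) ≡ v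
  vertexAt-last []      = refl
  vertexAt-last (r ∷ w) = vertexAt-last w

  vertexAt-∈ : ∀ {u v} (w : Walk u v) i → vertexAt w i ∈W w
  vertexAt-∈ []      zero    = refl
  vertexAt-∈ (r ∷ w) zero    = inj₁ refl
  vertexAt-∈ (r ∷ w) (suc i) = inj₂ (vertexAt-∈ w i)

  vertexAt-step : ∀ {u v} (w : Walk u v) (i : Fin (len w)) →
                  R (vertexAt w (inject₁ i)) (vertexAt w (suc i))
  vertexAt-step (r ∷ w) zero    = r
  vertexAt-step (r ∷ w) (suc i) = vertexAt-step w i

  Path : ∀ {u v} → Walk u v → Set
  Path []          = ⊤
  Path {u} (r ∷ w) = ¬ (u ∈W w) × Path w

  path-injective : ∀ {u v} (w : Walk u v) → Path w → Injective _≡_ _≡_ (vertexAt w)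
  path-injective []      _        {zero}  {zero}  _ = refl
  path-injective (r ∷ w) _        {zero}  {zero}  _ = refl
  path-injective (r ∷ w) (u∉ , _) {zero}  {suc j} e = ⊥-elim (u∉ (subst (_∈W w) (sym e) (vertexAt-∈ w j)))
  path-injective (r ∷ w) (u∉ , _) {suc i} {zero}  e = ⊥-elim (u∉ (subst (_∈W w) e (vertexAt-∈ w i)))
  path-injective (r ∷ w) (_ , pw) {suc i} {suc j} e = cong suc (path-injective w pw e)

  path⇒cycle : ∀ {a v} (w : Walk a v) → Path w → R v a → 2 ≤ len w → Cycle R (suc (len w))
  path⇒cycle {a} w pw r 2≤ = record
    { m = len w ; len≡ = refl ; long = s≤s 2≤ ; vtx = vertexAt w ; inj = path-injective w pw
    ; step = vertexAt-step w ; close = subst (λ z → R z a) (sym (vertexAt-last w)) r }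

  sequence⇒walk : ∀ {m} (f : Fin (suc m) → V) → (∀ (i : Fin m) → R (f (inject₁ i)) (f (suc i))) →
                  Σ (Walk (f zero) (f (fromℕ m))) λ w → len w ≡ m
  sequence⇒walk {zero}  f steps = [] , refl
  sequence⇒walk {suc m} f steps with sequence⇒walk (λ i → f (suc i)) (λ i → steps (suc i))
  ... | w , len≡ = steps zero ∷ w , cong suc len≡

  cycle⇒closedWalk : ∀ {k} → Cycle R k → Σ V λ v → Σ (Walk v v) λ w → len w ≡ k
  cycle⇒closedWalk c with sequence⇒walk (Cycle.vtx c) (Cycle.step c)
  ... | w , len≡ = _ , snoc w (Cycle.close c) ,
                   trans (len-snoc w (Cycle.close c)) (trans (cong suc len≡) (sym (Cycle.len≡ c)))

  -- Along a walk a proper 2-colouring alternates, so closed walks are even.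
  module TwoColoured (c : V → Parity) (proper : ∀ {u v} → R u v → c u ≢ c v) where

    colour-along : ∀ {u v} (w : Walk u v) → c v ≡ c u ⊕ parity (len w)
    colour-along {u} [] = sym (+-identityʳ (c u))
    colour-along {u} (_∷_ {w = x} r w) = begin
      c _                              ≡⟨ colour-along w ⟩
      c x ⊕ parity (len w)             ≡⟨ cong (_⊕ parity (len w)) (≢⇒opposite (proper r)) ⟩
      c u ⁻¹ ⊕ parity (len w)          ≡⟨ ⁻¹-shift (c u) (parity (len w)) ⟩
      c u ⊕ parity (len w) ⁻¹          ≡⟨ cong (c u ⊕_) (sym (parity-suc (len w))) ⟩
      c u ⊕ parity (suc (len w))       ∎
      where open ≡-Reasoning

    closedWalk-even : ∀ {v} (w : Walk v v) → parity (len w) ≢ 1ℙ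
    closedWalk-even {v} w odd = p≢p⁻¹ (c v) (trans (colour-along w) (trans (cong (c v ⊕_) odd) (⊕-comm (c v) 1ℙ)))

-- The two graphs we reason about (a tree T and its graph T̄ on E(T)) are
-- both instances of this record.
record FiniteGraph : Set₁ where
  field
    Vertex          : Set
    _~_             : Vertex → Vertex → Set
    ~-sym           : ∀ {u v} → u ~ v → v ~ u
    ~-irrefl        : ∀ {v} → ¬ (v ~ v)
    _~?_            : ∀ u v → Dec (u ~ v)
    _≟_             : DecidableEquality Vertex
    size            : ℕ
    enum            : Fin size → Vertex
    enum-surjective : ∀ v → Σ (Fin size) λ i → enum i ≡ v

module GraphTheory (G : FiniteGraph) where
  open FiniteGraph G
  open Walks _~_ public

  _∈?_ : ∀ {u v} (x : Vertex) (w : Walk u v) → Dec (x ∈W w)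
  _∈?_ {u} x []      = x ≟ u
  _∈?_ {u} x (r ∷ w) with x ≟ u | x ∈? w
  ... | yes x≡ | _      = yes (inj₁ x≡)
  ... | no _   | yes x∈ = yes (inj₂ x∈)
  ... | no x≢  | no x∉  = no λ { (inj₁ x≡) → x≢ x≡ ; (inj₂ x∈) → x∉ x∈ }

  LoopDecomposition : ∀ {u v} → Walk u v → Set
  LoopDecomposition {u} {v} w =
    Σ Vertex λ x → Σ (Walk u x) λ p → Σ (Walk x x) λ c → Σ (Walk x v) λ q →
      (w ≡ p ++ (c ++ q)) × (0 < len c)

  path-or-loop : ∀ {u v} (w : Walk u v) → Path w ⊎ LoopDecomposition w
  path-or-loop [] = inj₁ tt
  path-or-loop {u} (r ∷ w) with path-or-loop w
  ... | inj₂ (x , p , c , q , eq , pos) = inj₂ (x , r ∷ p , c , q , cong (r ∷_) eq , pos)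
  ... | inj₁ pw with u ∈? w
  ...   | no u∉  = inj₁ (u∉ , pw)
  ...   | yes u∈ with splitAt w u∈
  ...     | p , q , eq = inj₂ (u , [] , r ∷ p , q , cong (r ∷_) eq , s≤s z≤n)

  module _ {u x v} (p : Walk u x) (c : Walk x x) (q : Walk x v) where

    len-loop : len (p ++ (c ++ q)) ≡ len p + (len c + len q)
    len-loop = trans (len-++ p (c ++ q)) (cong (len p +_) (len-++ c q))

    cut-shorter : 0 < len c → len (p ++ q) < len (p ++ (c ++ q))
    cut-shorter pos = begin-strict
      len (p ++ q)                ≡⟨ len-++ p q ⟩
      len p + len q               <⟨ +-monoʳ-< (len p) (m<n+m (len q) pos) ⟩
      len p + (len c + len q)     ≡⟨ sym len-loop ⟩
      len (p ++ (c ++ q))         ∎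
      where open ≤-Reasoning

    cut-⊆ : ∀ {y} → y ∈W (p ++ q) → y ∈W (p ++ (c ++ q))
    cut-⊆ y∈ with ∈-++⁻ p q y∈
    ... | inj₁ y∈p = ∈-++ˡ p (c ++ q) y∈p
    ... | inj₂ y∈q = ∈-++ʳ p (c ++ q) (∈-++ʳ c q y∈q)

    cut-parity : parity (len c) ≡ 0ℙ → parity (len (p ++ q)) ≡ parity (len (p ++ (c ++ q)))
    cut-parity even = begin
      parity (len (p ++ q))                              ≡⟨ cong parity (len-++ p q) ⟩
      parity (len p + len q)                             ≡⟨ +-homo-+ (len p) (len q) ⟩
      parity (len p) ⊕ parity (len q)
        ≡⟨ cong (λ t → parity (len p) ⊕ (t ⊕ parity (len q))) (sym even) ⟩
      parity (len p) ⊕ (parity (len c) ⊕ parity (len q))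
        ≡⟨ cong (parity (len p) ⊕_) (sym (+-homo-+ (len c) (len q))) ⟩
      parity (len p) ⊕ parity (len c + len q)            ≡⟨ sym (+-homo-+ (len p) (len c + len q)) ⟩
      parity (len p + (len c + len q))                   ≡⟨ cong parity (sym len-loop) ⟩
      parity (len (p ++ (c ++ q)))                       ∎
      where open ≡-Reasoning

  shortcut : ∀ {u v} (w : Walk u v) →
             Σ (Walk u v) λ p → Path p × len p ≤ len w × (∀ {x} → x ∈W p → x ∈W w)
  shortcut w = go w (<-wellFounded (len w))
    where
      go : ∀ {u v} (w : Walk u v) → Acc _<_ (len w) →
           Σ (Walk u v) λ p → Path p × len p ≤ len w × (∀ {x} → x ∈W p → x ∈W w)
      go w (acc rec) with path-or-loop w
      ... | inj₁ pw = w , pw , ≤-refl , λ x∈ → x∈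
      ... | inj₂ (x , p , c , q , refl , pos) with go (p ++ q) (rec (cut-shorter p c q pos))
      ...   | p′ , pp′ , le , sub =
              p′ , pp′ , ≤-trans le (<⇒≤ (cut-shorter p c q pos)) , λ y∈ → cut-⊆ p c q (sub y∈)

  -- An odd closed walk contains an odd cycle: cut loops until none is left.
  oddClosedWalk⇒oddCycle : ∀ {v} (w : Walk v v) → parity (len w) ≡ 1ℙ →
                           Σ ℕ λ k → parity k ≡ 1ℙ × Cycle _~_ k
  oddClosedWalk⇒oddCycle w = go w (<-wellFounded (len w))
    where
      go : ∀ {v} (w : Walk v v) → Acc _<_ (len w) → parity (len w) ≡ 1ℙ →
           Σ ℕ λ k → parity k ≡ 1ℙ × Cycle _~_ k
      go []                      _         ()
      go (r ∷ [])                _         _   = ⊥-elim (~-irrefl r)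
      go (r ∷ (r′ ∷ []))         _         ()
      go (r ∷ w′@(_ ∷ (_ ∷ _))) (acc rec) odd with path-or-loop w′
      ... | inj₁ pw = _ , odd , path⇒cycle w′ pw r (s≤s (s≤s z≤n))
      ... | inj₂ (x , p , c , q , eq , pos) with parity (len c) in c-parity
      ...   | 1ℙ = go c (rec (s≤s c≤)) c-parity
        where
          c≤ : len c ≤ len w′
          c≤ = begin
            len c                       ≤⟨ m≤n+m (len c) (len p) ⟩
            len p + len c               ≤⟨ m≤m+n (len p + len c) (len q) ⟩
            len p + len c + len q       ≡⟨ +-assoc (len p) (len c) (len q) ⟩
            len p + (len c + len q)     ≡⟨ sym (len-loop p c q) ⟩
            len (p ++ (c ++ q))         ≡⟨ cong len (sym eq) ⟩
            len w′                      ∎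
            where open ≤-Reasoning
      ...   | 0ℙ = go (r ∷ (p ++ q)) (rec (s≤s shorter)) odd′
        where
          shorter : len (p ++ q) < len w′
          shorter = <-≤-trans (cut-shorter p c q pos) (≤-reflexive (cong len (sym eq)))
          odd′ : parity (suc (len (p ++ q))) ≡ 1ℙ
          odd′ = begin
            parity (suc (len (p ++ q)))          ≡⟨ parity-suc (len (p ++ q)) ⟩
            parity (len (p ++ q)) ⁻¹             ≡⟨ cong _⁻¹ (cut-parity p c q c-parity) ⟩
            parity (len (p ++ (c ++ q))) ⁻¹      ≡⟨ cong (λ t → parity (len t) ⁻¹) (sym eq) ⟩
            parity (len w′) ⁻¹                   ≡⟨ sym (parity-suc (len w′)) ⟩
            parity (suc (len w′))                ≡⟨ odd ⟩
            1ℙ                                   ∎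
            where open ≡-Reasoning

  cycle-through : ∀ {x y z} → x ~ y → y ~ z → x ≢ z → (w : Walk x z) → ¬ (y ∈W w) →
                  Σ ℕ (Cycle _~_)
  cycle-through {x} xy yz x≢z w y∉ with shortcut w
  ... | [] , _ , _ , _ = ⊥-elim (x≢z refl)
  ... | (r ∷ p) , pp , _ , sub =
        _ , path⇒cycle (~-sym xy ∷ r ∷ p) ((λ y∈ → y∉ (sub y∈)) , pp) (~-sym yz) (s≤s (s≤s z≤n))

  triangle⇒cycle : ∀ {u v w} → u ~ v → v ~ w → w ~ u → Cycle _~_ 3
  triangle⇒cycle {u} uv vw wu =
    path⇒cycle (uv ∷ vw ∷ []) (u∉ , (λ { refl → ~-irrefl vw }) , tt) wu (s≤s (s≤s z≤n))
    where
      u∉ : ¬ (u ∈W (vw ∷ []))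
      u∉ (inj₁ refl) = ~-irrefl uv
      u∉ (inj₂ refl) = ~-irrefl wu

  reverse : ∀ {u v} → Walk u v → Walk v u
  reverse []      = []
  reverse (r ∷ w) = snoc (reverse w) (~-sym r)

  len-reverse : ∀ {u v} (w : Walk u v) → len (reverse w) ≡ len w
  len-reverse []      = refl
  len-reverse (r ∷ w) = trans (len-snoc (reverse w) (~-sym r)) (cong suc (len-reverse w))

  ∈-reverse : ∀ {u v x} (w : Walk u v) → x ∈W reverse w → x ∈W w
  ∈-reverse []      x∈ = x∈
  ∈-reverse (r ∷ w) x∈ with ∈-++⁻ (reverse w) (~-sym r ∷ []) x∈
  ... | inj₁ x∈w        = inj₂ (∈-reverse w x∈w)
  ... | inj₂ (inj₁ x≡)  = inj₂ (subst (_∈W w) (sym x≡) (vertexAt-∈ w zero))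
  ... | inj₂ (inj₂ x≡)  = inj₁ x≡

  closeUp : ∀ {s u v} → Walk s u → u ~ v → Walk s v → Walk s s
  closeUp wu r wv = wu ++ (r ∷ reverse wv)

  closeUp-odd : ∀ {s u v} (wu : Walk s u) (r : u ~ v) (wv : Walk s v) →
                parity (len wu) ≡ parity (len wv) → parity (len (closeUp wu r wv)) ≡ 1ℙ
  closeUp-odd wu r wv same = begin
    parity (len (wu ++ (r ∷ reverse wv)))              ≡⟨ cong parity (len-++ wu (r ∷ reverse wv)) ⟩
    parity (len wu + suc (len (reverse wv)))           ≡⟨ +-homo-+ (len wu) _ ⟩
    parity (len wu) ⊕ parity (suc (len (reverse wv)))  ≡⟨ cong₂ _⊕_ same (parity-suc (len (reverse wv))) ⟩
    parity (len wv) ⊕ parity (len (reverse wv)) ⁻¹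
      ≡⟨ cong (λ t → parity (len wv) ⊕ parity t ⁻¹) (len-reverse wv) ⟩
    parity (len wv) ⊕ parity (len wv) ⁻¹               ≡⟨ p+p⁻¹≡1ℙ (parity (len wv)) ⟩
    1ℙ                                                 ∎
    where open ≡-Reasoning

  walk≤? : ∀ ℓ u v → Dec (Σ (Walk u v) λ w → len w ≤ ℓ)
  walk≤? zero u v with u ≟ v
  ... | yes refl = yes ([] , z≤n)
  ... | no u≢v   = no λ { ([] , _) → u≢v refl }
  walk≤? (suc ℓ) u v with u ≟ v
  ... | yes refl = yes ([] , z≤n)
  ... | no u≢v with any? (λ i → (u ~? enum i) ×-dec walk≤? ℓ (enum i) v)
  ...   | yes (i , r , w , le) = yes (r ∷ w , s≤s le)
  ...   | no none = no absent
    where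
      absent : ¬ Σ (Walk u v) λ w → len w ≤ suc ℓ
      absent ([] , _) = u≢v refl
      absent (_∷_ {w = x} r w , s≤s le) with enum-surjective x
      ... | i , refl = none (i , r , w , le)

  index : Vertex → Fin size
  index v = proj₁ (enum-surjective v)

  index-injective : Injective _≡_ _≡_ index
  index-injective {a} {b} e =
    trans (sym (proj₂ (enum-surjective a))) (trans (cong enum e) (proj₂ (enum-surjective b)))

  -- A path visits each of the `size` vertices at most once.
  path-short : ∀ {u v} (w : Walk u v) → Path w → len w < size
  path-short w pw = injective⇒≤ (λ e → path-injective w pw (index-injective e))

  -- Reachability is decidable: search walks no longer than a path can be.
  reachable? : ∀ u v → Dec (Walk u v)
  reachable? u v with walk≤? size u v
  ... | yes (w , _) = yes w
  ... | no none     = no λ w → let (p , pp , _ , _) = shortcut w in none (p , <⇒≤ (path-short p pp))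

  -- A graph without odd cycles is bipartite: colour each vertex by the parity
  -- of a walk from the least vertex of its component.
  module Bipartition (noOddCycle : ∀ k → parity k ≡ 1ℙ → ¬ Cycle _~_ k) where

    private
      firstReaching : ∀ v → Σ (Fin size) λ i → Walk (enum i) v × (∀ j → toℕ j < toℕ i → ¬ Walk (enum j) v)
      firstReaching v = leastFin (λ i → reachable? (enum i) v)
                                 (index v , subst (λ s → Walk s v) (sym (proj₂ (enum-surjective v))) [])

    root : Vertex → Fin size
    root v = proj₁ (firstReaching v)

    rootWalk : ∀ v → Walk (enum (root v)) v
    rootWalk v = proj₁ (proj₂ (firstReaching v))

    colour : Vertex → Parity
    colour v = parity (len (rootWalk v))

    -- Adjacent vertices lie in the same component, hence have the same root.
    root-adj : ∀ {u v} → u ~ v → root u ≡ root v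
    root-adj {u} {v} r with firstReaching u | firstReaching v
    ... | i , wi , below-i | j , wj , below-j with <-cmp i j
    ...   | tri≈ _ i≡j _ = i≡j
    ...   | tri< i<j _ _ = ⊥-elim (below-j i i<j (snoc wi r))
    ...   | tri> _ _ j<i = ⊥-elim (below-i j j<i (snoc wj (~-sym r)))

    colour-proper : ∀ {u v} → u ~ v → colour u ≢ colour v
    colour-proper {u} {v} r = same-root⇒different (cong enum (root-adj r)) (rootWalk u) (rootWalk v)
      where
        same-root⇒different : ∀ {s s′} → s ≡ s′ → (wu : Walk s u) (wv : Walk s′ v) →
                              parity (len wu) ≢ parity (len wv)
        same-root⇒different refl wu wv same with oddClosedWalk⇒oddCycle (closeUp wu r wv) (closeUp-odd wu r wv same)
        ... | k , odd , cyc = noOddCycle k odd cyc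

  bipartite : (∀ k → parity k ≡ 1ℙ → ¬ Cycle _~_ k) →
              Σ (Vertex → Parity) λ c → ∀ {u v} → u ~ v → c u ≢ c v
  bipartite noOddCycle = colour , colour-proper
    where open Bipartition noOddCycle

module Edges {n : ℕ} (G : Graph n) where

  Adj-sym : ∀ {a b} → Adj G a b → Adj G b a
  Adj-sym {a} {b} ab = trans (Graph.sym G b a) ab

  _Adj?_ : ∀ a b → Dec (Adj G a b)
  a Adj? b = adj G a b Bool.≟ true

  edge-adj : (e : Edge G) → Adj G (src e) (tgt e)
  edge-adj (edge a b _ ab) = recompute (a Adj? b) ab

  edge-ord : (e : Edge G) → src e Fin.< tgt e
  edge-ord (edge a b a<b _) = recompute (a <ᶠ? b) a<b

  edge-ext : ∀ {e f : Edge G} → src e ≡ src f → tgt e ≡ tgt f → e ≡ f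
  edge-ext {edge a b _ _} {edge .a .b _ _} refl refl = refl

  _≟ᴱ_ : DecidableEquality (Edge G)
  e ≟ᴱ f with src e Fin.≟ src f | tgt e Fin.≟ tgt f
  ... | yes s≡ | yes t≡ = yes (edge-ext s≡ t≡)
  ... | no s≢  | _      = no λ e≡f → s≢ (cong src e≡f)
  ... | _      | no t≢  = no λ e≡f → t≢ (cong tgt e≡f)

  Ends? : ∀ (e : Edge G) a b → Dec (Ends e a b)
  Ends? e a b = ((src e Fin.≟ a) ×-dec (tgt e Fin.≟ b)) ⊎-dec ((src e Fin.≟ b) ×-dec (tgt e Fin.≟ a))

  ends-adj : ∀ (e : Edge G) {a b} → Ends e a b → Adj G a b
  ends-adj e (inj₁ (refl , refl)) = edge-adj e
  ends-adj e (inj₂ (refl , refl)) = Adj-sym (edge-adj e)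

  ends-swap : ∀ (e : Edge G) {a b} → Ends e a b → Ends e b a
  ends-swap e (inj₁ ends) = inj₂ ends
  ends-swap e (inj₂ ends) = inj₁ ends

  ends-distinct : ∀ (e : Edge G) {a b} → Ends e a b → a ≢ b
  ends-distinct e ends refl = irrefl G _ (ends-adj e ends)

  ends-other : ∀ (e : Edge G) {a b c d} → Ends e a b → Ends e c d → a ≢ c → a ≢ d → ⊥
  ends-other e (inj₁ (refl , refl)) (inj₁ (p , _)) a≢c _   = a≢c p
  ends-other e (inj₁ (refl , refl)) (inj₂ (p , _)) _   a≢d = a≢d p
  ends-other e (inj₂ (refl , refl)) (inj₁ (_ , q)) _   a≢d = a≢d q
  ends-other e (inj₂ (refl , refl)) (inj₂ (_ , q)) a≢c _   = a≢c q

  ends-unique : ∀ (e f : Edge G) {a b} → Ends e a b → Ends f a b → e ≡ f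
  ends-unique e f (inj₁ (s , t)) (inj₁ (s′ , t′)) = edge-ext (trans s (sym s′)) (trans t (sym t′))
  ends-unique e f (inj₂ (s , t)) (inj₂ (s′ , t′)) = edge-ext (trans s (sym s′)) (trans t (sym t′))
  ends-unique e f (inj₁ (refl , refl)) (inj₂ (s′ , t′)) =
    ⊥-elim (<-asym (edge-ord e) (subst₂ Fin._<_ s′ t′ (edge-ord f)))
  ends-unique e f (inj₂ (refl , refl)) (inj₁ (s′ , t′)) =
    ⊥-elim (<-asym (edge-ord e) (subst₂ Fin._<_ s′ t′ (edge-ord f)))

  edgeBetween : ∀ a b → Adj G a b → Σ (Edge G) λ e → Ends e a b
  edgeBetween a b ab with <-cmp a b
  ... | tri< a<b _ _ = edge a b a<b ab , inj₁ (refl , refl)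
  ... | tri≈ _ refl _ = ⊥-elim (irrefl G a ab)
  ... | tri> _ _ b<a = edge b a b<a (Adj-sym ab) , inj₂ (refl , refl)

  ConsecutiveTriple : Set
  ConsecutiveTriple = Σ (Edge G) λ e₁ → Σ (Edge G) λ e₂ → Σ (Edge G) λ e₃ → Consecutive e₁ e₂ e₃

  path⇒consecutive : ∀ {x y z u} → Adj G x y → Adj G y z → Adj G z u → x ≢ z → y ≢ u → x ≢ u →
                     ConsecutiveTriple
  path⇒consecutive {x} {y} {z} {u} xy yz zu x≢z y≢u x≢u
    with edgeBetween x y xy | edgeBetween y z yz | edgeBetween z u zu
  ... | e₁ , E₁ | e₂ , E₂ | e₃ , E₃ =
    e₁ , e₂ , e₃ ,
    (λ { refl → ends-other e₁ E₁ E₂ (ends-distinct e₁ E₁) x≢z }) ,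
    (λ { refl → ends-other e₂ E₂ E₃ (ends-distinct e₂ E₂) y≢u }) ,
    (λ { refl → ends-other e₁ E₁ E₃ x≢z x≢u }) ,
    x , y , z , u , E₁ , E₂ , E₃

  -- In a star every edge contains the centre, so no three edges are consecutive.
  star⇒no-consecutive : IsStar G → ∀ e₁ e₂ e₃ → ¬ Consecutive e₁ e₂ e₃
  star⇒no-consecutive (_ , c , _ , central) e₁ e₂ e₃ (e₁≢e₂ , e₂≢e₃ , _ , x , y , z , u , E₁ , E₂ , E₃)
    with central y z (ends-adj e₂ E₂)
  ... | inj₁ refl with central z u (ends-adj e₃ E₃)
  ...   | inj₁ refl = ends-distinct e₂ E₂ refl
  ...   | inj₂ refl = e₂≢e₃ (ends-unique e₂ e₃ E₂ (ends-swap e₃ E₃))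
  star⇒no-consecutive (_ , c , _ , central) e₁ e₂ e₃ (e₁≢e₂ , e₂≢e₃ , _ , x , y , z , u , E₁ , E₂ , E₃)
      | inj₂ refl with central x y (ends-adj e₁ E₁)
  ...   | inj₂ refl = ends-distinct e₂ E₂ refl
  ...   | inj₁ refl = e₁≢e₂ (ends-unique e₁ e₂ E₁ (ends-swap e₂ E₂))

  consecutive? : ∀ e₁ e₂ e₃ → Dec (Consecutive e₁ e₂ e₃)
  consecutive? e₁ e₂ e₃ =
    ¬? (e₁ ≟ᴱ e₂) ×-dec ¬? (e₂ ≟ᴱ e₃) ×-dec ¬? (e₁ ≟ᴱ e₃) ×-dec
    any? λ x → any? λ y → any? λ z → any? λ u → Ends? e₁ x y ×-dec Ends? e₂ y z ×-dec Ends? e₃ z u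

  bar-sym : ∀ {x y} → BarAdj G x y → BarAdj G y x
  bar-sym {x} {y} (e , x≢e , e≢y , x≢y , a , b , c , d , Ex , Ee , Ey) =
    e , (λ p → e≢y (sym p)) , (λ p → x≢e (sym p)) , (λ p → x≢y (sym p)) ,
    d , c , b , a , ends-swap y Ey , ends-swap e Ee , ends-swap x Ex

  bar-irrefl : ∀ {x} → ¬ BarAdj G x x
  bar-irrefl (_ , _ , _ , x≢x , _) = x≢x refl

  -- Enumerating edges by their ordered pairs of ends (e₀ fills the non-edges).
  module Enumeration (e₀ : Edge G) where

    pairEdge : Fin n × Fin n → Edge G
    pairEdge (a , b) with a <ᶠ? b | a Adj? b
    ... | yes a<b | yes ab = edge a b a<b ab
    ... | _       | _      = e₀

    pairEdge-ends : ∀ (e : Edge G) → pairEdge (src e , tgt e) ≡ e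
    pairEdge-ends e@(edge a b _ _) with a <ᶠ? b | a Adj? b
    ... | yes _   | yes _  = refl
    ... | no a≮b  | _      = ⊥-elim (a≮b (edge-ord e))
    ... | yes _   | no ¬ab = ⊥-elim (¬ab (edge-adj e))

    enumEdge : Fin (n * n) → Edge G
    enumEdge i = pairEdge (remQuot {n} n i)

    enumEdge-surjective : ∀ e → Σ (Fin (n * n)) λ i → enumEdge i ≡ e
    enumEdge-surjective e =
      combine (src e) (tgt e) , trans (cong pairEdge (remQuot-combine (src e) (tgt e))) (pairEdge-ends e)

    bar? : ∀ x y → Dec (BarAdj G x y)
    bar? x y with any? (λ i → consecutive? x (enumEdge i) y)
    ... | yes (i , cons) = yes (enumEdge i , cons)
    ... | no none = no λ { (e , cons) → none (proj₁ (enumEdge-surjective e) ,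
                            subst (λ f → Consecutive x f y) (sym (proj₂ (enumEdge-surjective e))) cons) }

    barGraph : FiniteGraph
    barGraph = record
      { Vertex = Edge G ; _~_ = BarAdj G ; ~-sym = bar-sym ; ~-irrefl = bar-irrefl ; _~?_ = bar?
      ; _≟_ = _≟ᴱ_ ; size = n * n ; enum = enumEdge ; enum-surjective = enumEdge-surjective }

  graph : FiniteGraph
  graph = record
    { Vertex = Fin n ; _~_ = Adj G ; ~-sym = Adj-sym ; ~-irrefl = irrefl G _ ; _~?_ = _Adj?_
    ; _≟_ = Fin._≟_ ; size = n ; enum = λ i → i ; enum-surjective = λ v → v , refl }

-- Injective edge colourings of G are proper vertex colourings of Ḡ

module Colourings {n : ℕ} (G : Graph n) where
  open Edges G

  colouring-proper : ∀ {k} (col : InjectiveEdgeColouring G k) →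
                     ∀ {x y} → BarAdj G x y → proj₁ col x ≢ proj₁ col y
  colouring-proper (_ , injective) (e , cons) = injective _ e _ cons

  proper⇒colouring : ∀ {k} (c : Edge G → Fin k) → (∀ {x y} → BarAdj G x y → c x ≢ c y) →
                     InjectiveEdgeColouring G k
  proper⇒colouring c proper = c , λ x e y cons → proper (e , cons)

  weaken : ∀ {k m} → InjectiveEdgeColouring G k → k ≤ m → InjectiveEdgeColouring G m
  weaken (c , injective) k≤m =
    (λ e → inject≤ (c e) k≤m) , λ x e y cons same → injective x e y cons (inject≤-injective k≤m k≤m _ _ same)

  lower-bound : ∀ {m} → ¬ InjectiveEdgeColouring G m → ∀ k → InjectiveEdgeColouring G k → suc m ≤ k
  lower-bound {m} none k col with suc m ≤? k
  ... | yes m<k = m<k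
  ... | no  m≮k = ⊥-elim (none (weaken col (≤-pred (≰⇒> m≮k))))

  χᵢ'-exact : ∀ {m} → InjectiveEdgeColouring G (suc m) → ¬ InjectiveEdgeColouring G m → χᵢ'≡ G (suc m)
  χᵢ'-exact col none = col , lower-bound none

  no-0-colouring : Edge G → ¬ InjectiveEdgeColouring G 0
  no-0-colouring e (c , _) with c e
  ... | ()

  one-colouring : ¬ ConsecutiveTriple → InjectiveEdgeColouring G 1
  one-colouring none = (λ _ → zero) , λ e₁ e₂ e₃ cons _ → none (e₁ , e₂ , e₃ , cons)

  no-1-colouring : ConsecutiveTriple → ¬ InjectiveEdgeColouring G 1
  no-1-colouring (e₁ , e₂ , e₃ , cons) (c , injective) with c e₁ in c₁ | c e₃ in c₃
  ... | zero | zero = injective e₁ e₂ e₃ cons (trans c₁ (sym c₃))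

  -- An odd cycle of Ḡ is an odd closed walk, which no proper 2-colouring allows.
  no-2-colouring : BarHasOddCycle G → ¬ InjectiveEdgeColouring G 2
  no-2-colouring (k , odd , cyc) col@(c , _) =
    let (_ , w , len≡k) = cycle⇒closedWalk cyc in
    closedWalk-even w (trans (cong parity len≡k) (odd⇒parity odd))
    where
      open Walks (BarAdj G)
      open TwoColoured (λ e → toParity (c e)) (λ bar same → colouring-proper col bar (toParity-injective same))

  -- Without odd cycles Ḡ is bipartite: two colours suffice.
  two-colouring : Edge G → ¬ BarHasOddCycle G → InjectiveEdgeColouring G 2
  two-colouring e₀ noOdd =
    let (c , proper) = bipartite (λ k odd cyc → noOdd (k , parity⇒odd k odd , cyc)) in
    proper⇒colouring (λ e → fromParity (c e)) (λ bar same → proper bar (fromParity-injective same))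
    where open GraphTheory (Enumeration.barGraph e₀)

OneApart : ℕ → ℕ → Set
OneApart a b = suc a ≡ b ⊎ suc b ≡ a

rot : Fin 3 → Fin 3
rot zero             = suc zero
rot (suc zero)       = suc (suc zero)
rot (suc (suc zero)) = zero

mod3 : ℕ → Fin 3
mod3 zero    = zero
mod3 (suc k) = rot (mod3 k)

mod3-suc≢ : ∀ k → mod3 k ≢ mod3 (suc k)
mod3-suc≢ k with mod3 k
... | zero             = λ ()
... | suc zero         = λ ()
... | suc (suc zero)   = λ ()

mod3-suc²≢ : ∀ k → mod3 k ≢ mod3 (suc (suc k))
mod3-suc²≢ k with mod3 k
... | zero             = λ ()
... | suc zero         = λ ()
... | suc (suc zero)   = λ ()

max-up : ∀ a → a ⊔ suc a ≡ suc a
max-up a = m≤n⇒m⊔n≡n (n≤1+n a)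

max-down : ∀ a → suc a ⊔ a ≡ suc a
max-down a = m≥n⇒m⊔n≡m (n≤1+n a)

subst-mod3≢ : ∀ {p q P Q} → p ≡ P → q ≡ Q → mod3 P ≢ mod3 Q → mod3 p ≢ mod3 q
subst-mod3≢ refl refl ne = ne

-- The depths a b c e along a walk x y z u of three consecutive tree edges
-- change by one at each step, and neither y nor z has both of its walk
-- neighbours as parents.  Then the deeper ends of the first and the last
-- edge differ in depth by one or two, hence modulo 3.
depth-profile-mod3 : ∀ a b c e → OneApart a b → OneApart b c → OneApart c e →
                     ¬ (suc a ≡ b × suc c ≡ b) → ¬ (suc b ≡ c × suc e ≡ c) →
                     mod3 (a ⊔ b) ≢ mod3 (c ⊔ e)
depth-profile-mod3 a _ _ _ (inj₁ refl) (inj₁ refl) (inj₁ refl) _ _ =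
  subst-mod3≢ (max-up a) (max-up (suc (suc a))) (mod3-suc²≢ (suc a))
depth-profile-mod3 a _ _ _ (inj₁ refl) (inj₁ refl) (inj₂ refl) _ _ =
  subst-mod3≢ (max-up a) (max-down (suc a)) (mod3-suc≢ (suc a))
depth-profile-mod3 a _ _ _ (inj₁ refl) (inj₂ c<b) _ y-two-parents _ =
  ⊥-elim (y-two-parents (refl , c<b))
depth-profile-mod3 _ b _ _ (inj₂ refl) (inj₁ refl) (inj₁ refl) _ _ =
  subst-mod3≢ (max-down b) (max-up (suc b)) (mod3-suc≢ (suc b))
depth-profile-mod3 _ b _ _ (inj₂ refl) (inj₁ refl) (inj₂ e<c) _ z-two-parents =
  ⊥-elim (z-two-parents (refl , e<c))
depth-profile-mod3 _ _ c _ (inj₂ refl) (inj₂ refl) (inj₁ refl) _ _ =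
  subst-mod3≢ (max-down (suc c)) (max-up c) (λ eq → mod3-suc≢ (suc c) (sym eq))
depth-profile-mod3 _ _ _ e (inj₂ refl) (inj₂ refl) (inj₂ refl) _ _ =
  subst-mod3≢ (max-down (suc (suc e))) (max-down e) (λ eq → mod3-suc²≢ (suc e) (sym eq))

-- Depths in a rooted tree

module RootedTree {n : ℕ} (T : Graph n) (connected : Connected T) (acyclic : Acyclic T) (r : Fin n) where
  open Edges T
  open GraphTheory graph

  star⇒walk : ∀ {a b} → Star (Adj T) a b → Walk a b
  star⇒walk ε        = []
  star⇒walk (ab ◅ s) = ab ∷ star⇒walk s

  -- The depth of v is the length of a shortest walk from the root to v.  It
  -- is opaque: only depthWalk, depth-minimal and len-depthWalk are used
  -- below, and unfolding the underlying search makes type checking slow.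
  opaque
    private
      shortest : ∀ v → Σ ℕ λ m → (Σ (Walk r v) λ w → len w ≤ m) ×
                                 (∀ k → k < m → ¬ Σ (Walk r v) λ w → len w ≤ k)
      shortest v = leastℕ (λ ℓ → walk≤? ℓ r v) _ (star⇒walk (connected r v) , ≤-refl)

    depth : Fin n → ℕ
    depth v = proj₁ (shortest v)

    depthWalk : ∀ v → Walk r v
    depthWalk v = proj₁ (proj₁ (proj₂ (shortest v)))

    depth-minimal : ∀ {v} (w : Walk r v) → depth v ≤ len w
    depth-minimal {v} w with depth v ≤? len w
    ... | yes ok = ok
    ... | no  w< = ⊥-elim (proj₂ (proj₂ (shortest v)) (len w) (≰⇒> w<) (w , ≤-refl))

    len-depthWalk : ∀ v → len (depthWalk v) ≡ depth v
    len-depthWalk v = ≤-antisym (proj₂ (proj₁ (proj₂ (shortest v)))) (depth-minimal (depthWalk v))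

  depth-root : depth r ≡ 0
  depth-root = n≤0⇒n≡0 (depth-minimal [])

  depth≡0⇒root : ∀ {v} → depth v ≡ 0 → v ≡ r
  depth≡0⇒root {v} d≡0 = sym (len0⇒≡ (depthWalk v) (trans (len-depthWalk v) d≡0))

  depth-∈ : ∀ {v z} (w : Walk r v) → z ∈W w → depth z ≤ len w
  depth-∈ w z∈ with splitAt w z∈
  ... | p , q , refl = ≤-trans (depth-minimal p) (≤-trans (m≤m+n (len p) (len q)) (≤-reflexive (sym (len-++ p q))))

  depth-step : ∀ {u v} → Adj T u v → depth v ≤ suc (depth u)
  depth-step {u} uv = ≤-trans (depth-minimal (snoc (depthWalk u) uv))
                              (≤-reflexive (trans (len-snoc (depthWalk u) uv) (cong suc (len-depthWalk u))))

  -- ... and never by zero, since two adjacent vertices of equal depth close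
  -- an odd walk, hence an odd cycle.
  depth-adj-≢ : ∀ {u v} → Adj T u v → depth u ≢ depth v
  depth-adj-≢ {u} {v} uv same
    with oddClosedWalk⇒oddCycle (closeUp (depthWalk u) uv (depthWalk v))
           (closeUp-odd (depthWalk u) uv (depthWalk v)
             (cong parity (trans (len-depthWalk u) (trans same (sym (len-depthWalk v))))))
  ... | k , _ , cyc = acyclic k cyc

  depth-adj : ∀ {u v} → Adj T u v → OneApart (depth u) (depth v)
  depth-adj {u} {v} uv with ℕ-cmp (depth u) (depth v)
  ... | tri< u<v _ _ = inj₁ (≤-antisym u<v (depth-step uv))
  ... | tri≈ _ same _ = ⊥-elim (depth-adj-≢ uv same)
  ... | tri> _ _ v<u = inj₂ (≤-antisym v<u (depth-step (Adj-sym uv)))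

  Parent : Fin n → Fin n → Set
  Parent u v = Adj T u v × suc (depth u) ≡ depth v

  -- Every vertex other than the root has a parent: the penultimate vertex
  -- of a shortest walk from the root.
  parent : ∀ v → 0 < depth v → Σ (Fin n) λ u → Parent u v
  parent v pos with lastStep (depthWalk v) (<-≤-trans pos (≤-reflexive (sym (len-depthWalk v))))
  ... | u , w , uv , len≡ =
    u , uv , ≤-antisym (≤-trans (s≤s (depth-minimal w)) (≤-reflexive (trans (sym len≡) (len-depthWalk v))))
                       (depth-step uv)

  -- The parent is unique: two parents x ≠ z of y would be joined by a walk
  -- through their shortest walks, which avoid the deeper y, closing a cycle.
  parent-unique : ∀ {x y z} → Parent x y → Parent z y → x ≡ z
  parent-unique {x} {y} {z} (xy , dx) (zy , dz) with x Fin.≟ z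
  ... | yes x≡z = x≡z
  ... | no  x≢z with cycle-through xy (Adj-sym zy) x≢z (reverse (depthWalk x) ++ depthWalk z) y∉
    where
      too-deep : ∀ {w} → y ∈W depthWalk w → suc (depth w) ≡ depth y → ⊥
      too-deep {w} y∈ dw = <-irrefl refl (≤-trans (≤-reflexive dw)
                             (≤-trans (depth-∈ (depthWalk w) y∈) (≤-reflexive (len-depthWalk w))))
      y∉ : ¬ (y ∈W (reverse (depthWalk x) ++ depthWalk z))
      y∉ y∈ with ∈-++⁻ (reverse (depthWalk x)) (depthWalk z) y∈
      ... | inj₁ y∈x = too-deep (∈-reverse (depthWalk x) y∈x) dx
      ... | inj₂ y∈z = too-deep y∈z dz
  ...   | k , cyc = ⊥-elim (acyclic k cyc)

  heightColour : Edge T → Fin 3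
  heightColour e = mod3 (depth (src e) ⊔ depth (tgt e))

  heightColour-ends : ∀ e {a b} → Ends e a b → heightColour e ≡ mod3 (depth a ⊔ depth b)
  heightColour-ends e (inj₁ (refl , refl)) = refl
  heightColour-ends e (inj₂ (refl , refl)) = cong mod3 (⊔-comm (depth (src e)) (depth (tgt e)))

  heightColouring : InjectiveEdgeColouring T 3
  heightColouring = heightColour , injective
    where
      injective : ∀ e₁ e₂ e₃ → Consecutive e₁ e₂ e₃ → heightColour e₁ ≢ heightColour e₃
      injective e₁ e₂ e₃ (e₁≢e₂ , e₂≢e₃ , _ , x , y , z , u , E₁ , E₂ , E₃) same =
        depth-profile-mod3 (depth x) (depth y) (depth z) (depth u)
          (depth-adj xy) (depth-adj yz) (depth-adj zu) y-one-parent z-one-parent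
          (trans (sym (heightColour-ends e₁ E₁)) (trans same (heightColour-ends e₃ E₃)))
        where
          xy : Adj T x y
          xy = ends-adj e₁ E₁
          yz : Adj T y z
          yz = ends-adj e₂ E₂
          zu : Adj T z u
          zu = ends-adj e₃ E₃
          y-one-parent : ¬ (suc (depth x) ≡ depth y × suc (depth z) ≡ depth y)
          y-one-parent (dx , dz) with parent-unique (xy , dx) (Adj-sym yz , dz)
          ... | refl = e₁≢e₂ (ends-unique e₁ e₂ E₁ (ends-swap e₂ E₂))
          z-one-parent : ¬ (suc (depth y) ≡ depth z × suc (depth u) ≡ depth z)
          z-one-parent (dy , du) with parent-unique (yz , dy) (Adj-sym zu , du)
          ... | refl = e₂≢e₃ (ends-unique e₂ e₃ E₂ (ends-swap e₃ E₃))

  deeper⇒≢ : ∀ {a b} → depth b < depth a → a ≢ b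
  deeper⇒≢ b<a refl = <-irrefl refl b<a

  parent-depth : ∀ {u v k} → Parent u v → suc k ≤ depth v → k ≤ depth u
  parent-depth (_ , du) k<v = ≤-pred (≤-trans k<v (≤-reflexive (sym du)))

  -- A vertex of depth ≥ 3 and its three nearest ancestors form a path
  -- of three consecutive edges.
  deep⇒consecutive : ∀ v → 3 ≤ depth v → ConsecutiveTriple
  deep⇒consecutive v 3≤v with parent v (≤-trans (s≤s z≤n) 3≤v)
  ... | p₁ , P₁ with parent p₁ (≤-trans (s≤s z≤n) (parent-depth P₁ 3≤v))
  ...   | p₂ , P₂ with parent p₂ (parent-depth P₂ (parent-depth P₁ 3≤v))
  ...     | p₃ , P₃ =
    path⇒consecutive (Adj-sym (proj₁ P₁)) (Adj-sym (proj₁ P₂)) (Adj-sym (proj₁ P₃))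
      (deeper⇒≢ (<-trans (below P₂) (below P₁))) (deeper⇒≢ (<-trans (below P₃) (below P₂)))
      (deeper⇒≢ (<-trans (below P₃) (<-trans (below P₂) (below P₁))))
    where
      below : ∀ {u w} → Parent u w → depth u < depth w
      below (_ , du) = ≤-reflexive du

  depth1⇒child : ∀ {v} → depth v ≡ 1 → Adj T r v
  depth1⇒child {v} d≡1 with parent v (≤-reflexive (sym d≡1))
  ... | u , uv , du with depth≡0⇒root (suc-injective (trans du d≡1))
  ...   | refl = uv

  child⇒depth1 : ∀ {v} → Adj T r v → depth v ≡ 1
  child⇒depth1 rv with depth-adj rv
  ... | inj₁ d≡ = trans (sym d≡) (cong suc depth-root)
  ... | inj₂ d≡ = ⊥-elim (1+n≢0 (trans d≡ depth-root))

  -- A vertex adjacent to all others is the centre of a star, as a tree has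
  -- no triangles.
  universal⇒star : Edge T → ∀ c → (∀ v → v ≢ c → Adj T c v) → IsStar T
  universal⇒star e₀ c universal = e₀ , c , universal , central
    where
      central : ∀ a b → Adj T a b → a ≡ c ⊎ b ≡ c
      central a b ab with a Fin.≟ c | b Fin.≟ c
      ... | yes a≡c | _       = inj₁ a≡c
      ... | no _    | yes b≡c = inj₂ b≡c
      ... | no a≢c  | no b≢c  =
        ⊥-elim (acyclic 3 (triangle⇒cycle (universal a a≢c) ab (Adj-sym (universal b b≢c))))

  shallow⇒star : Edge T → (∀ v → depth v ≤ 1) → IsStar T
  shallow⇒star e₀ shallow = universal⇒star e₀ r λ v v≢r → depth1⇒child (depth1 v v≢r)
    where
      depth1 : ∀ v → v ≢ r → depth v ≡ 1
      depth1 v v≢r with depth v in d≡ | shallow v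
      ... | zero         | _       = ⊥-elim (v≢r (depth≡0⇒root d≡))
      ... | suc zero     | _       = refl
      ... | suc (suc _)  | s≤s ()

  lone-child⇒star : Edge T → (∀ v → depth v ≤ 2) → ∀ p → Adj T r p → (∀ w → Adj T r w → w ≡ p) →
                    IsStar T
  lone-child⇒star e₀ shallow p rp only = universal⇒star e₀ p universal
    where
      universal : ∀ w → w ≢ p → Adj T p w
      universal w w≢p with depth w in d≡ | shallow w
      ... | zero                | _ with depth≡0⇒root d≡
      ...   | refl = Adj-sym rp
      universal w w≢p | suc zero | _ = ⊥-elim (w≢p (only w (depth1⇒child d≡)))
      universal w w≢p | suc (suc zero) | _ with parent w (subst (1 ≤_) (sym d≡) (s≤s z≤n))
      ...   | u , uw , du with only u (depth1⇒child (suc-injective (trans du d≡)))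
      ...     | refl = uw
      universal w w≢p | suc (suc (suc _)) | s≤s (s≤s ())

  -- A vertex v of depth 2 hangs below a child p of the root.  Either the root
  -- has another child w, and v p r w is a path, or p is the only child.
  depth2⇒consecutive⊎star : Edge T → (∀ v → depth v ≤ 2) → ∀ v → depth v ≡ 2 →
                            ConsecutiveTriple ⊎ IsStar T
  depth2⇒consecutive⊎star e₀ shallow v d≡2 with parent v (≤-trans (s≤s z≤n) (≤-reflexive (sym d≡2)))
  ... | p , pv , dp with depth1⇒child (suc-injective (trans dp d≡2))
  ...   | rp with any? (λ w → (r Adj? w) ×-dec ¬? (w Fin.≟ p))
  ...     | yes (w , rw , w≢p) =
    inj₁ (path⇒consecutive (Adj-sym pv) (Adj-sym rp) rw v≢r (λ p≡w → w≢p (sym p≡w)) v≢w)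
    where
      v≢r : v ≢ r
      v≢r = deeper⇒≢ (subst₂ _<_ (sym depth-root) (sym d≡2) (s≤s z≤n))
      v≢w : v ≢ w
      v≢w = deeper⇒≢ (subst₂ _<_ (sym (child⇒depth1 rw)) (sym d≡2) ≤-refl)
  ...     | no none = inj₂ (lone-child⇒star e₀ shallow p rp only)
    where
      only : ∀ w → Adj T r w → w ≡ p
      only w rw with w Fin.≟ p
      ... | yes w≡p = w≡p
      ... | no  w≢p = ⊥-elim (none (w , rw , w≢p))

  depth-dichotomy : ∀ k → Σ (Fin n) (λ v → k ≤ depth v) ⊎ (∀ v → depth v < k)
  depth-dichotomy k with any? (λ v → k ≤? depth v)
  ... | yes deep = inj₁ deep
  ... | no  none = inj₂ λ v → ≰⇒> λ k≤v → none (v , k≤v)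

  nonStar⇒consecutive : Edge T → ¬ IsStar T → ConsecutiveTriple
  nonStar⇒consecutive e₀ ¬star with depth-dichotomy 3
  ... | inj₁ (v , 3≤v) = deep⇒consecutive v 3≤v
  ... | inj₂ below3 with depth-dichotomy 2
  ...   | inj₁ (v , 2≤v) = [ (λ triple → triple) , (λ star → ⊥-elim (¬star star)) ]′
                             (depth2⇒consecutive⊎star e₀ ≤2 v (≤-antisym (≤2 v) 2≤v))
    where
      ≤2 : ∀ w → depth w ≤ 2
      ≤2 w = ≤-pred (below3 w)
  ...   | inj₂ below2 = ⊥-elim (¬star (shallow⇒star e₀ λ w → ≤-pred (below2 w)))

proposition16 : (n : ℕ) (T : Graph n) → IsTree T → HasEdge T →
    (IsStar T → χᵢ'≡ T 1) ×
    (BarHasOddCycle T → χᵢ'≡ T 3) ×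
    (¬ IsStar T → ¬ BarHasOddCycle T → χᵢ'≡ T 2)
proposition16 n T (connected , acyclic) e₀ = star-case , odd-cycle-case , other-case
  where
    open Edges T
    open Colourings T
    open RootedTree T connected acyclic (src e₀)

    star-case : IsStar T → χᵢ'≡ T 1
    star-case star = χᵢ'-exact (one-colouring no-triple) (no-0-colouring e₀)
      where
        no-triple : ¬ ConsecutiveTriple
        no-triple (e₁ , e₂ , e₃ , cons) = star⇒no-consecutive star e₁ e₂ e₃ cons

    odd-cycle-case : BarHasOddCycle T → χᵢ'≡ T 3
    odd-cycle-case odd = χᵢ'-exact heightColouring (no-2-colouring odd)

    other-case : ¬ IsStar T → ¬ BarHasOddCycle T → χᵢ'≡ T 2
    other-case ¬star ¬odd =
      χᵢ'-exact (two-colouring e₀ ¬odd) (no-1-colouring (nonStar⇒consecutive e₀ ¬star))
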